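{- Let $\mathbf{s}=(s_1,\dots,s_r)\in\mathbb{Z}^r$ and $\boldsymbol{\epsilon}=(\epsilon_1,\dots,\epsilon_r)\in\{\pm1\}^r$. Then for every integer $n\geq 1$, \[ C_n^{\mathbf{s};\boldsymbol{\epsilon}}=(-1)^n \sum_{n+1\geq m_1>\cdots>m_r>0} \frac{\epsilon_1^{m_1}\cdots\epsilon_r^{m_r}(-1)^{m_1-1}(m_1-1)!\left\{\begin{array}{c} n+1\\ m_1\end{array}\right\}}{m_1^{s_1}\cdots m_r^{s_r}}. \]
   Context: For $\mathbf{s}=(s_1,\dots,s_r)\in\mathbb{Z}^r$, $\mathrm{Li}_{\mathbf{s}}(z_1,\dots,z_r)=\sum_{n_1>\cdots>n_r\geq1}\frac{z_1^{n_1}\cdots z_r^{n_r}}{n_1^{s_1}\cdots n_r^{s_r}}$. For $\boldsymbol{\epsilon}\in\{\pm1\}^r$, the rationals $C_n^{\mathbf{s};\boldsymbol{\epsilon}}$ are defined by $\sum_{n\geq0}C_n^{\mathbf{s};\boldsymbol{\epsilon}}\frac{x^n}{n!}=e^{ -x}\frac{\mathrm{Li}_{\mathbf{s}}((1-e^{ -x})\epsilon_1,\epsilon_2,\dots,\epsilon_r)}{1-e^{ -x}}$. The Stirling numbers of the second kind $\left\{\begin{array}{c} n\\ m\end{array}\right\}$ are defined by $(e^x-1)^m=m!\sum_{n\geq m}\left\{\begin{array}{c} n\\ m\end{array}\right\}\frac{x^n}{n!}$. -}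

module Defs where

open import Data.Nat as ℕ using (ℕ; zero; suc; _!; _∸_)
open import Data.Nat.Properties using (m^n≢0; _!≢0)
open import Data.Integer as ℤ using (ℤ; +_; -[1+_])
open import Data.Rational using (ℚ; 0ℚ; 1ℚ; _+_; _*_; -_; _/_)
open import Data.Sign using (Sign)
open import Data.Vec using (Vec; []; _∷_)

ℕ→ℚ : ℕ → ℚ
ℕ→ℚ n = (+ n) / 1

_^ℚ_ : ℚ → ℕ → ℚ
q ^ℚ zero  = 1ℚ
q ^ℚ suc n = q * (q ^ℚ n)

sgn : Sign → ℚ
sgn Sign.+ = 1ℚ
sgn Sign.- = - 1ℚ

-- 1 / (suc k) ^ s  for s ∈ ℤ, i.e. m^{-s} with m = suc k ≥ 1
invPow : ℕ → ℤ → ℚ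
invPow k (+ n)     = (+ 1) / (suc k ℕ.^ n)
  where instance _ = m^n≢0 (suc k) n
invPow k -[1+ n ]  = ℕ→ℚ (suc k ℕ.^ suc n)

invFact : ℕ → ℚ
invFact n = (+ 1) / (n !)
  where instance _ = n !≢0

sumBelow : ℕ → (ℕ → ℚ) → ℚ
sumBelow zero    f = 0ℚ
sumBelow (suc n) f = sumBelow n f + f n

-- Nested sums
-- nested s ε N = Σ_{N > m₁ > m₂ > ⋯ > m_k ≥ 1} ∏ᵢ εᵢ^{mᵢ} / mᵢ^{sᵢ}
-- (empty product / empty index list gives 1)

term : ℤ → Sign → ℕ → ℚ
term s e zero    = 0ℚ              -- never used (indices are ≥ 1)
term s e (suc k) = (sgn e ^ℚ suc k) * invPow k s

nested : ∀ {k} → Vec ℤ k → Vec Sign k → ℕ → ℚ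
nested []       []       N = 1ℚ
nested (s ∷ ss) (e ∷ es) N =
  sumBelow N (λ m → term s e m * nested ss es m) -- m = 0 contributes 0

FPS : Set
FPS = ℕ → ℚ

_⊛_ : FPS → FPS → FPS
(f ⊛ g) n = sumBelow (suc n) (λ i → f i * g (n ∸ i))

_^S_ : FPS → ℕ → FPS
f ^S zero  = λ n → (case n) where
  case : ℕ → ℚ
  case zero    = 1ℚ
  case (suc _) = 0ℚ
f ^S suc k = f ⊛ (f ^S k)

-- substitution A(g(x)) of a series g with g 0 = 0 into a series A(t):
-- coefficient of x^n only involves the terms t^k with k ≤ n.
-- (Only meaningful when g 0 = 0, which holds at every use below.)
subst : FPS → FPS → FPS
subst A g n = sumBelow (suc n) (λ k → A k * (g ^S k) n)

expNeg : FPS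
expNeg n = ((- 1ℚ) ^ℚ n) * invFact n

oneMinusExpNeg : FPS
oneMinusExpNeg zero    = 0ℚ
oneMinusExpNeg (suc n) = - expNeg (suc n)

expMinusOne : FPS
expMinusOne zero    = 0ℚ
expMinusOne (suc n) = invFact (suc n)

-- Li_s(t ε₁, ε₂, …, ε_r) as a power series in t, for r = suc r':
-- coefficient of t^k is  Σ_{k = n₁ > n₂ > ⋯ > n_r ≥ 1} ε₁^{n₁}⋯ε_r^{n_r}/(n₁^{s₁}⋯n_r^{s_r})
-- (the factor ε₁^{n₁} comes from (t ε₁)^{n₁}).

liCoeff : ∀ {r} → Vec ℤ (suc r) → Vec Sign (suc r) → FPS
liCoeff (s ∷ ss) (e ∷ es) k = term s e k * nested ss es k

-- Li_s(t ε₁, ε₂, …)/t as a power series in t (Li has zero constant term)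
liOverT : ∀ {r} → Vec ℤ (suc r) → Vec Sign (suc r) → FPS
liOverT s ε k = liCoeff s ε (suc k)

-- Σ_n C_n x^n/n! = e^{-x} Li_s((1-e^{-x})ε₁, ε₂, …, ε_r) / (1-e^{-x})
C : ∀ {r} → Vec ℤ (suc r) → Vec Sign (suc r) → ℕ → ℚ
C s ε n = ℕ→ℚ (n !) * (expNeg ⊛ subst (liOverT s ε) oneMinusExpNeg) n

-- Stirling numbers of the second kind, via (e^x-1)^m = m! Σ_n S(n,m) x^n/n!

stirling2 : ℕ → ℕ → ℚ
stirling2 n m = ℕ→ℚ (n !) * invFact m * (expMinusOne ^S m) n

-- Write g = 1 - e^{-x} and A(t) = Li_s(t ε₁, ε₂, …)/t = Σ A_k t^k, so that
-- C_n = n! [x^n] Σ_k A_k e^{-x} g^k.  Since g' = e^{-x} = 1 - g, the chain rule gives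
-- (k+1) e^{-x} g^k = (g^{k+1})', hence n! [x^n] e^{-x} g^k = (n+1)!/(k+1) [x^{n+1}] g^{k+1}.
-- As g(x) = - (e^{-x} - 1), the coefficient of x^{n+1} in g^{k+1} is (-1)^{n+k} times that
-- of (e^x - 1)^{k+1}, i.e. (-1)^{n+k} (k+1)!/(n+1)! S(n+1, k+1).  Altogether
-- n! [x^n] e^{-x} g^k = (-1)^{n+k} k! S(n+1, k+1), and m₁ = k + 1 gives the formula.
module Submission where

open import Defs
open import Data.Nat using (ℕ; suc; _!; _∸_; _≥_)
open import Data.Integer using (ℤ)
open import Data.Rational using (ℚ; _*_; -_; 1ℚ)
open import Data.Sign using (Sign)
open import Data.Vec using (Vec; _∷_)
open import Relation.Binary.PropositionalEquality using (_≡_)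

open import Data.Nat as ℕ using (zero; _≤_; _<_; z≤n; s≤s)
import Data.Nat.Properties as ℕ
open import Data.Integer as ℤ using (+_)
import Data.Integer.Properties as ℤ
open import Data.Rational using (_+_; _-_; 0ℚ; fromℚᵘ; _/_)
open import Data.Rational.Properties
open import Data.Rational.Solver using (module +-*-Solver)
import Data.Rational.Unnormalised as ℚᵘ
import Data.Rational.Unnormalised.Properties as ℚᵘ
open import Data.Sum using (inj₁; inj₂)
open import Relation.Binary.PropositionalEquality using (refl; sym; trans; cong; cong₂; module ≡-Reasoning)

open +-*-Solver
open import Algebra.Properties.Ring +-*-ring using (x[y-z]≈xy-xz; [y-z]x≈yx-zx)

fromℚᵘ-homo-+ : ∀ p q → fromℚᵘ (p ℚᵘ.+ q) ≡ fromℚᵘ p + fromℚᵘ q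
fromℚᵘ-homo-+ p q = toℚᵘ-injective (ℚᵘ.≃-trans (toℚᵘ-fromℚᵘ (p ℚᵘ.+ q))
  (ℚᵘ.≃-sym (ℚᵘ.≃-trans (toℚᵘ-homo-+ (fromℚᵘ p) (fromℚᵘ q))
     (ℚᵘ.+-cong (toℚᵘ-fromℚᵘ p) (toℚᵘ-fromℚᵘ q)))))

fromℚᵘ-homo-* : ∀ p q → fromℚᵘ (p ℚᵘ.* q) ≡ fromℚᵘ p * fromℚᵘ q
fromℚᵘ-homo-* p q = toℚᵘ-injective (ℚᵘ.≃-trans (toℚᵘ-fromℚᵘ (p ℚᵘ.* q))
  (ℚᵘ.≃-sym (ℚᵘ.≃-trans (toℚᵘ-homo-* (fromℚᵘ p) (fromℚᵘ q))
     (ℚᵘ.*-cong (toℚᵘ-fromℚᵘ p) (toℚᵘ-fromℚᵘ q)))))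

-- ℕ→ℚ n reduces to fromℚᵘ (ℕ→ℚᵘ n), so ℕ→ℚ inherits the arithmetic of ℚᵘ through fromℚᵘ.
ℕ→ℚᵘ : ℕ → ℚᵘ.ℚᵘ
ℕ→ℚᵘ n = ℚᵘ.mkℚᵘ (+ n) 0

ℕ→ℚ-homo-+ : ∀ m n → ℕ→ℚ (m ℕ.+ n) ≡ ℕ→ℚ m + ℕ→ℚ n
ℕ→ℚ-homo-+ m n = trans (fromℚᵘ-cong {ℕ→ℚᵘ (m ℕ.+ n)} {ℕ→ℚᵘ m ℚᵘ.+ ℕ→ℚᵘ n} (ℚᵘ.*≡* eq))
  (fromℚᵘ-homo-+ (ℕ→ℚᵘ m) (ℕ→ℚᵘ n))
  where
  eq : + (m ℕ.+ n) ℤ.* + 1 ≡ (+ m ℤ.* + 1 ℤ.+ + n ℤ.* + 1) ℤ.* + 1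
  eq rewrite ℤ.*-identityʳ (+ m) | ℤ.*-identityʳ (+ n) = cong (ℤ._* + 1) (ℤ.pos-+ m n)

ℕ→ℚ-homo-* : ∀ m n → ℕ→ℚ (m ℕ.* n) ≡ ℕ→ℚ m * ℕ→ℚ n
ℕ→ℚ-homo-* m n = trans (fromℚᵘ-cong {ℕ→ℚᵘ (m ℕ.* n)} {ℕ→ℚᵘ m ℚᵘ.* ℕ→ℚᵘ n} (ℚᵘ.*≡* eq))
  (fromℚᵘ-homo-* (ℕ→ℚᵘ m) (ℕ→ℚᵘ n))
  where
  eq : + (m ℕ.* n) ℤ.* + 1 ≡ (+ m ℤ.* + n) ℤ.* + 1
  eq = cong (ℤ._* + 1) (ℤ.pos-* m n)

ℕ→ℚ-*-inverse : ∀ d .{{_ : ℕ.NonZero d}} → ℕ→ℚ d * ((+ 1) / d) ≡ 1ℚ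
ℕ→ℚ-*-inverse (suc k) = trans (sym (fromℚᵘ-homo-* (ℕ→ℚᵘ (suc k)) (ℚᵘ.mkℚᵘ (+ 1) k)))
  (fromℚᵘ-cong {ℕ→ℚᵘ (suc k) ℚᵘ.* ℚᵘ.mkℚᵘ (+ 1) k} {ℕ→ℚᵘ 1} (ℚᵘ.*≡* eq))
  where
  eq : (+ suc k ℤ.* + 1) ℤ.* + 1 ≡ + 1 ℤ.* (+ 1 ℤ.* + suc k)
  eq = trans (ℤ.*-identityʳ (+ suc k ℤ.* + 1)) (trans (ℤ.*-identityʳ (+ suc k))
         (sym (trans (ℤ.*-identityˡ (+ 1 ℤ.* + suc k)) (ℤ.*-identityˡ (+ suc k)))))

^ℚ-homo-+ : ∀ q m n → q ^ℚ (m ℕ.+ n) ≡ (q ^ℚ m) * (q ^ℚ n)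
^ℚ-homo-+ q zero    n = sym (*-identityˡ (q ^ℚ n))
^ℚ-homo-+ q (suc m) n = trans (cong (q *_) (^ℚ-homo-+ q m n)) (sym (*-assoc q (q ^ℚ m) (q ^ℚ n)))

ℕ→ℚ-cancelˡ : ∀ d .{{_ : ℕ.NonZero d}} {x y} → ℕ→ℚ d * x ≡ ℕ→ℚ d * y → x ≡ y
ℕ→ℚ-cancelˡ d {x} {y} eq = begin
    x                    ≡⟨ sym (*-identityˡ x) ⟩
    1ℚ * x               ≡⟨ cong (_* x) (sym (ℕ→ℚ-*-inverse d)) ⟩
    (q * q⁻¹) * x        ≡⟨ reassoc q q⁻¹ x ⟩
    q⁻¹ * (q * x)        ≡⟨ cong (q⁻¹ *_) eq ⟩
    q⁻¹ * (q * y)        ≡⟨ sym (reassoc q q⁻¹ y) ⟩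
    (q * q⁻¹) * y        ≡⟨ cong (_* y) (ℕ→ℚ-*-inverse d) ⟩
    1ℚ * y               ≡⟨ *-identityˡ y ⟩
    y                    ∎
  where
  open ≡-Reasoning
  q = ℕ→ℚ d
  q⁻¹ = (+ 1) / d
  reassoc : ∀ a b c → (a * b) * c ≡ b * (a * c)
  reassoc = solve 3 (λ a b c → (a :* b) :* c := b :* (a :* c)) refl

sumBelow-cong : ∀ n {f h : ℕ → ℚ} → (∀ i → i < n → f i ≡ h i) → sumBelow n f ≡ sumBelow n h
sumBelow-cong zero    eq = refl
sumBelow-cong (suc n) eq = cong₂ _+_ (sumBelow-cong n (λ i i<n → eq i (ℕ.m<n⇒m<1+n i<n))) (eq n (ℕ.n<1+n n))

sumBelow-zero : ∀ n {f : ℕ → ℚ} → (∀ i → i < n → f i ≡ 0ℚ) → sumBelow n f ≡ 0ℚ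
sumBelow-zero n eq = trans (sumBelow-cong n eq) (zeros n)
  where
  zeros : ∀ n → sumBelow n (λ _ → 0ℚ) ≡ 0ℚ
  zeros zero    = refl
  zeros (suc n) = cong (_+ 0ℚ) (zeros n)

sumBelow-+ : ∀ n (f h : ℕ → ℚ) → sumBelow n (λ i → f i + h i) ≡ sumBelow n f + sumBelow n h
sumBelow-+ zero    f h = refl
sumBelow-+ (suc n) f h = trans (cong (_+ (f n + h n)) (sumBelow-+ n f h))
  (solve 4 (λ a b c d → (a :+ b) :+ (c :+ d) := (a :+ c) :+ (b :+ d)) refl
     (sumBelow n f) (sumBelow n h) (f n) (h n))

sumBelow-- : ∀ n (f h : ℕ → ℚ) → sumBelow n (λ i → f i - h i) ≡ sumBelow n f - sumBelow n h
sumBelow-- zero    f h = refl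
sumBelow-- (suc n) f h = trans (cong (_+ (f n - h n)) (sumBelow-- n f h))
  (solve 4 (λ a b c d → (a :- b) :+ (c :- d) := (a :+ c) :- (b :+ d)) refl
     (sumBelow n f) (sumBelow n h) (f n) (h n))

*-distribˡ-sumBelow : ∀ n c (f : ℕ → ℚ) → c * sumBelow n f ≡ sumBelow n (λ i → c * f i)
*-distribˡ-sumBelow zero    c f = *-zeroʳ c
*-distribˡ-sumBelow (suc n) c f =
  trans (*-distribˡ-+ c (sumBelow n f) (f n)) (cong (_+ c * f n) (*-distribˡ-sumBelow n c f))

sumBelow-suc : ∀ n (f : ℕ → ℚ) → sumBelow (suc n) f ≡ f 0 + sumBelow n (λ i → f (suc i))
sumBelow-suc zero    f = trans (+-identityˡ (f 0)) (sym (+-identityʳ (f 0)))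
sumBelow-suc (suc n) f = trans (cong (_+ f (suc n)) (sumBelow-suc n f))
  (+-assoc (f 0) (sumBelow n (λ i → f (suc i))) (f (suc n)))

sumBelow-suc-of-zero : ∀ n (f : ℕ → ℚ) → f 0 ≡ 0ℚ → sumBelow (suc n) f ≡ sumBelow n (λ i → f (suc i))
sumBelow-suc-of-zero n f f0≡0 = trans (sumBelow-suc n f)
  (trans (cong (_+ sumBelow n (λ i → f (suc i))) f0≡0) (+-identityˡ (sumBelow n (λ i → f (suc i)))))

sumBelow-comm : ∀ m n (f : ℕ → ℕ → ℚ) →
  sumBelow m (λ i → sumBelow n (f i)) ≡ sumBelow n (λ k → sumBelow m (λ i → f i k))
sumBelow-comm zero    n f = sym (sumBelow-zero n (λ _ _ → refl))
sumBelow-comm (suc m) n f = trans (cong (_+ sumBelow n (f m)) (sumBelow-comm m n f))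
  (sym (sumBelow-+ n (λ k → sumBelow m (λ i → f i k)) (f m)))

sumBelow-extend : ∀ {m n} (f : ℕ → ℚ) → m ≤ n → (∀ i → m ≤ i → i < n → f i ≡ 0ℚ) →
  sumBelow n f ≡ sumBelow m f
sumBelow-extend {n = zero} f z≤n eq = refl
sumBelow-extend {m} {suc n} f m≤1+n eq with ℕ.m≤n⇒m<n∨m≡n m≤1+n
... | inj₂ refl      = refl
... | inj₁ (s≤s m≤n) = trans
  (cong₂ _+_ (sumBelow-extend f m≤n (λ i m≤i i<n → eq i m≤i (ℕ.m<n⇒m<1+n i<n))) (eq n m≤n (ℕ.n<1+n n)))
  (+-identityʳ (sumBelow m f))

𝟙 : FPS
𝟙 zero    = 1ℚ
𝟙 (suc _) = 0ℚ

∂ : FPS → FPS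
∂ f n = ℕ→ℚ (suc n) * f (suc n)

⊛-congˡ : ∀ {a b} f → (∀ i → a i ≡ b i) → ∀ n → (a ⊛ f) n ≡ (b ⊛ f) n
⊛-congˡ f eq n = sumBelow-cong (suc n) (λ i _ → cong (_* f (n ∸ i)) (eq i))

⊛-congʳ : ∀ f {a b} → (∀ i → a i ≡ b i) → ∀ n → (f ⊛ a) n ≡ (f ⊛ b) n
⊛-congʳ f eq n = sumBelow-cong (suc n) (λ i _ → cong (f i *_) (eq (n ∸ i)))

⊛-identityˡ : ∀ f n → (𝟙 ⊛ f) n ≡ f n
⊛-identityˡ f n = begin
    (𝟙 ⊛ f) n                                        ≡⟨ sumBelow-suc n (λ i → 𝟙 i * f (n ∸ i)) ⟩
    1ℚ * f n + sumBelow n (λ i → 0ℚ * f (n ∸ suc i))  ≡⟨ cong₂ _+_ (*-identityˡ (f n)) tail ⟩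
    f n + 0ℚ                                         ≡⟨ +-identityʳ (f n) ⟩
    f n                                              ∎
  where
  open ≡-Reasoning
  tail = sumBelow-zero n (λ i _ → *-zeroˡ (f (n ∸ suc i)))

⊛-distribʳ-- : ∀ a b f n → ((λ i → a i - b i) ⊛ f) n ≡ (a ⊛ f) n - (b ⊛ f) n
⊛-distribʳ-- a b f n = trans
  (sumBelow-cong (suc n) (λ i _ → [y-z]x≈yx-zx (f (n ∸ i)) (a i) (b i)))
  (sumBelow-- (suc n) (λ i → a i * f (n ∸ i)) (λ i → b i * f (n ∸ i)))

⊛-distribˡ-- : ∀ f a b n → (f ⊛ (λ i → a i - b i)) n ≡ (f ⊛ a) n - (f ⊛ b) n
⊛-distribˡ-- f a b n = trans
  (sumBelow-cong (suc n) (λ i _ → x[y-z]≈xy-xz (f i) (a (n ∸ i)) (b (n ∸ i))))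
  (sumBelow-- (suc n) (λ i → f i * a (n ∸ i)) (λ i → f i * b (n ∸ i)))

⊛-*ʳ : ∀ f c a n → (f ⊛ (λ i → c * a i)) n ≡ c * (f ⊛ a) n
⊛-*ʳ f c a n = trans
  (sumBelow-cong (suc n) (λ i _ → solve 3 (λ x y z → x :* (y :* z) := y :* (x :* z)) refl (f i) c (a (n ∸ i))))
  (sym (*-distribˡ-sumBelow (suc n) c (λ i → f i * a (n ∸ i))))

∂-⊛ : ∀ f h n → ∂ (f ⊛ h) n ≡ (∂ f ⊛ h) n + (f ⊛ ∂ h) n
∂-⊛ f h n = begin
    ℕ→ℚ (suc n) * sumBelow (suc (suc n)) (λ i → f i * h (suc n ∸ i))
  ≡⟨ *-distribˡ-sumBelow (suc (suc n)) (ℕ→ℚ (suc n)) _ ⟩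
    sumBelow (suc (suc n)) (λ i → ℕ→ℚ (suc n) * (f i * h (suc n ∸ i)))
  ≡⟨ sumBelow-cong (suc (suc n)) (λ i i<n+2 → split i (ℕ.≤-pred i<n+2)) ⟩
    sumBelow (suc (suc n)) (λ i → left i + right i)
  ≡⟨ sumBelow-+ (suc (suc n)) left right ⟩
    sumBelow (suc (suc n)) left + sumBelow (suc (suc n)) right
  ≡⟨ cong₂ _+_ left-sum right-sum ⟩
    (∂ f ⊛ h) n + (f ⊛ ∂ h) n
  ∎
  where
  open ≡-Reasoning
  left right : ℕ → ℚ
  left  i = (ℕ→ℚ i * f i) * h (suc n ∸ i)
  right i = f i * (ℕ→ℚ (suc n ∸ i) * h (suc n ∸ i))

  split : ∀ i → i ≤ suc n → ℕ→ℚ (suc n) * (f i * h (suc n ∸ i)) ≡ left i + right i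
  split i i≤1+n = begin
      ℕ→ℚ (suc n) * (f i * h (suc n ∸ i))
    ≡⟨ cong (λ m → ℕ→ℚ m * (f i * h (suc n ∸ i))) (sym (ℕ.m+[n∸m]≡n i≤1+n)) ⟩
      ℕ→ℚ (i ℕ.+ (suc n ∸ i)) * (f i * h (suc n ∸ i))
    ≡⟨ cong (_* (f i * h (suc n ∸ i))) (ℕ→ℚ-homo-+ i (suc n ∸ i)) ⟩
      (ℕ→ℚ i + ℕ→ℚ (suc n ∸ i)) * (f i * h (suc n ∸ i))
    ≡⟨ solve 4 (λ I J F H → (I :+ J) :* (F :* H) := (I :* F) :* H :+ F :* (J :* H)) refl
         (ℕ→ℚ i) (ℕ→ℚ (suc n ∸ i)) (f i) (h (suc n ∸ i)) ⟩
      left i + right i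
    ∎

  left-sum : sumBelow (suc (suc n)) left ≡ (∂ f ⊛ h) n
  left-sum = begin
      sumBelow (suc (suc n)) left
    ≡⟨ sumBelow-suc (suc n) left ⟩
      (0ℚ * f 0) * h (suc n) + (∂ f ⊛ h) n
    ≡⟨ cong (_+ (∂ f ⊛ h) n) (solve 2 (λ F H → (con 0ℚ :* F) :* H := con 0ℚ) refl (f 0) (h (suc n))) ⟩
      0ℚ + (∂ f ⊛ h) n
    ≡⟨ +-identityˡ ((∂ f ⊛ h) n) ⟩
      (∂ f ⊛ h) n
    ∎

  right-sum : sumBelow (suc (suc n)) right ≡ (f ⊛ ∂ h) n
  right-sum = begin
      sumBelow (suc n) right + f (suc n) * (ℕ→ℚ (n ∸ n) * h (n ∸ n))
    ≡⟨ cong₂ _+_ (sumBelow-cong (suc n) (λ i i<1+n → cong (λ m → f i * (ℕ→ℚ m * h m)) (ℕ.+-∸-assoc 1 (ℕ.≤-pred i<1+n))))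
                 (cong (λ m → f (suc n) * (ℕ→ℚ m * h m)) (ℕ.n∸n≡0 n)) ⟩
      (f ⊛ ∂ h) n + f (suc n) * (0ℚ * h 0)
    ≡⟨ cong (_+_ ((f ⊛ ∂ h) n)) (solve 2 (λ F H → F :* (con 0ℚ :* H) := con 0ℚ) refl (f (suc n)) (h 0)) ⟩
      (f ⊛ ∂ h) n + 0ℚ
    ≡⟨ +-identityʳ ((f ⊛ ∂ h) n) ⟩
      (f ⊛ ∂ h) n
    ∎

^S-vanish : ∀ g → g 0 ≡ 0ℚ → ∀ k j → j < k → (g ^S k) j ≡ 0ℚ
^S-vanish g g0≡0 (suc k) j (s≤s j≤k) = sumBelow-zero (suc j) term≡0
  where
  term≡0 : ∀ i → i < suc j → g i * (g ^S k) (j ∸ i) ≡ 0ℚ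
  term≡0 zero    _         = trans (cong (_* (g ^S k) j) g0≡0) (*-zeroˡ ((g ^S k) j))
  term≡0 (suc i) (s≤s i<j) = trans
    (cong (g (suc i) *_) (^S-vanish g g0≡0 k (j ∸ suc i) (ℕ.<-≤-trans (ℕ.∸-monoʳ-< {j} {suc i} {0} (s≤s z≤n) i<j) j≤k)))
    (*-zeroʳ (g (suc i)))

∂-^S-zero : ∀ f n → ∂ (f ^S 0) n ≡ 0ℚ
∂-^S-zero f n = *-zeroʳ (ℕ→ℚ (suc n))

∂-^S : ∀ g → (∀ i → ∂ g i ≡ 𝟙 i - g i) →
  ∀ k n → ∂ (g ^S suc k) n ≡ ℕ→ℚ (suc k) * ((g ^S k) n - (g ^S suc k) n)
∂-^S g g′ k n = begin
    ∂ (g ⊛ (g ^S k)) n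
  ≡⟨ ∂-⊛ g (g ^S k) n ⟩
    (∂ g ⊛ (g ^S k)) n + (g ⊛ ∂ (g ^S k)) n
  ≡⟨ cong (_+ (g ⊛ ∂ (g ^S k)) n) g′⊛g^k ⟩
    Δ k + (g ⊛ ∂ (g ^S k)) n
  ≡⟨ cong (_+_ (Δ k)) (g⊛∂[g^k] k) ⟩
    Δ k + ℕ→ℚ k * Δ k
  ≡⟨ solve 2 (λ d K → d :+ K :* d := (con 1ℚ :+ K) :* d) refl (Δ k) (ℕ→ℚ k) ⟩
    (1ℚ + ℕ→ℚ k) * Δ k
  ≡⟨ cong (_* Δ k) (sym (ℕ→ℚ-homo-+ 1 k)) ⟩
    ℕ→ℚ (suc k) * Δ k
  ∎
  where
  open ≡-Reasoning
  Δ : ℕ → ℚ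
  Δ k = (g ^S k) n - (g ^S suc k) n

  g′⊛g^k : (∂ g ⊛ (g ^S k)) n ≡ Δ k
  g′⊛g^k = trans (⊛-congˡ (g ^S k) g′ n)
    (trans (⊛-distribʳ-- 𝟙 g (g ^S k) n) (cong (_- (g ^S suc k) n) (⊛-identityˡ (g ^S k) n)))

  g⊛∂[g^k] : ∀ k → (g ⊛ ∂ (g ^S k)) n ≡ ℕ→ℚ k * Δ k
  g⊛∂[g^k] zero = trans (sumBelow-zero (suc n) (λ i _ → trans (cong (g i *_) (∂-^S-zero g (n ∸ i))) (*-zeroʳ (g i))))
                        (sym (*-zeroˡ (Δ zero)))
  g⊛∂[g^k] (suc k) = begin
      (g ⊛ ∂ (g ^S suc k)) n
    ≡⟨ ⊛-congʳ g (∂-^S g g′ k) n ⟩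
      (g ⊛ (λ i → ℕ→ℚ (suc k) * ((g ^S k) i - (g ^S suc k) i))) n
    ≡⟨ ⊛-*ʳ g (ℕ→ℚ (suc k)) (λ i → (g ^S k) i - (g ^S suc k) i) n ⟩
      ℕ→ℚ (suc k) * (g ⊛ (λ i → (g ^S k) i - (g ^S suc k) i)) n
    ≡⟨ cong (ℕ→ℚ (suc k) *_) (⊛-distribˡ-- g (g ^S k) (g ^S suc k) n) ⟩
      ℕ→ℚ (suc k) * Δ (suc k)
    ∎

alt : ℕ → ℚ
alt n = (- 1ℚ) ^ℚ n

alt-split : ∀ {i N} → i ≤ N → alt i * alt (N ∸ i) ≡ alt N
alt-split {i} {N} i≤N = trans (sym (^ℚ-homo-+ (- 1ℚ) i (N ∸ i))) (cong alt (ℕ.m+[n∸m]≡n i≤N))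

-- g(x) = - E(- x) forces g(x)^k = (- 1)^k E(- x)^k.
^S-reflect : ∀ g E → (∀ i → g i ≡ - (alt i * E i)) →
  ∀ k N → (g ^S k) N ≡ alt k * alt N * (E ^S k) N
^S-reflect g E g≡-E[-x] zero    zero    = refl
^S-reflect g E g≡-E[-x] zero    (suc N) = sym (*-zeroʳ (alt 0 * alt (suc N)))
^S-reflect g E g≡-E[-x] (suc k) N = begin
    sumBelow (suc N) (λ i → g i * (g ^S k) (N ∸ i))
  ≡⟨ sumBelow-cong (suc N) (λ i i<1+N → summand i (ℕ.≤-pred i<1+N)) ⟩
    sumBelow (suc N) (λ i → alt (suc k) * alt N * (E i * (E ^S k) (N ∸ i)))
  ≡⟨ sym (*-distribˡ-sumBelow (suc N) (alt (suc k) * alt N) (λ i → E i * (E ^S k) (N ∸ i))) ⟩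
    alt (suc k) * alt N * (E ^S suc k) N
  ∎
  where
  open ≡-Reasoning
  summand : ∀ i → i ≤ N → g i * (g ^S k) (N ∸ i) ≡ alt (suc k) * alt N * (E i * (E ^S k) (N ∸ i))
  summand i i≤N = begin
      g i * (g ^S k) (N ∸ i)
    ≡⟨ cong₂ _*_ (g≡-E[-x] i) (^S-reflect g E g≡-E[-x] k (N ∸ i)) ⟩
      - (alt i * E i) * (alt k * alt (N ∸ i) * (E ^S k) (N ∸ i))
    ≡⟨ solve 5 (λ Ai Ei Ak Aj Ej → (:- (Ai :* Ei)) :* (Ak :* Aj :* Ej) := (:- con 1ℚ :* Ak :* (Ai :* Aj)) :* (Ei :* Ej)) refl
         (alt i) (E i) (alt k) (alt (N ∸ i)) ((E ^S k) (N ∸ i)) ⟩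
      alt (suc k) * (alt i * alt (N ∸ i)) * (E i * (E ^S k) (N ∸ i))
    ≡⟨ cong (λ a → alt (suc k) * a * (E i * (E ^S k) (N ∸ i))) (alt-split i≤N) ⟩
      alt (suc k) * alt N * (E i * (E ^S k) (N ∸ i))
    ∎

⊛-subst : ∀ f A g → g 0 ≡ 0ℚ → ∀ n →
  (f ⊛ subst A g) n ≡ sumBelow (suc n) (λ k → A k * (f ⊛ (g ^S k)) n)
⊛-subst f A g g0≡0 n = begin
    sumBelow (suc n) (λ i → f i * sumBelow (suc (n ∸ i)) (summand (n ∸ i)))
  ≡⟨ sumBelow-cong (suc n) (λ i _ → cong (f i *_) (sym (extend i))) ⟩
    sumBelow (suc n) (λ i → f i * sumBelow (suc n) (summand (n ∸ i)))
  ≡⟨ sumBelow-cong (suc n) (λ i _ → *-distribˡ-sumBelow (suc n) (f i) (summand (n ∸ i))) ⟩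
    sumBelow (suc n) (λ i → sumBelow (suc n) (λ k → f i * summand (n ∸ i) k))
  ≡⟨ sumBelow-comm (suc n) (suc n) (λ i k → f i * summand (n ∸ i) k) ⟩
    sumBelow (suc n) (λ k → sumBelow (suc n) (λ i → f i * summand (n ∸ i) k))
  ≡⟨ sumBelow-cong (suc n) (λ k _ → factor k) ⟩
    sumBelow (suc n) (λ k → A k * (f ⊛ (g ^S k)) n)
  ∎
  where
  open ≡-Reasoning
  summand : ℕ → ℕ → ℚ
  summand j k = A k * (g ^S k) j

  extend : ∀ i → sumBelow (suc n) (summand (n ∸ i)) ≡ sumBelow (suc (n ∸ i)) (summand (n ∸ i))
  extend i = sumBelow-extend (summand (n ∸ i)) (s≤s (ℕ.m∸n≤m n i))
    (λ k n-i<k _ → trans (cong (A k *_) (^S-vanish g g0≡0 k (n ∸ i) n-i<k)) (*-zeroʳ (A k)))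

  factor : ∀ k → sumBelow (suc n) (λ i → f i * summand (n ∸ i) k) ≡ A k * (f ⊛ (g ^S k)) n
  factor k = trans
    (sumBelow-cong (suc n) (λ i _ → solve 3 (λ x y z → x :* (y :* z) := y :* (x :* z)) refl (f i) (A k) ((g ^S k) (n ∸ i))))
    (sym (*-distribˡ-sumBelow (suc n) (A k) (λ i → f i * (g ^S k) (n ∸ i))))

ℕ→ℚ-!-*-invFact : ∀ n → ℕ→ℚ (n !) * invFact n ≡ 1ℚ
ℕ→ℚ-!-*-invFact n = ℕ→ℚ-*-inverse (n !) {{n ℕ.!≢0}}

invFact-suc : ∀ n → ℕ→ℚ (suc n) * invFact (suc n) ≡ invFact n
invFact-suc n = ℕ→ℚ-cancelˡ (n !) {{n ℕ.!≢0}} (begin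
    ℕ→ℚ (n !) * (ℕ→ℚ (suc n) * invFact (suc n))
  ≡⟨ solve 3 (λ F N I → F :* (N :* I) := (N :* F) :* I) refl (ℕ→ℚ (n !)) (ℕ→ℚ (suc n)) (invFact (suc n)) ⟩
    (ℕ→ℚ (suc n) * ℕ→ℚ (n !)) * invFact (suc n)
  ≡⟨ cong (_* invFact (suc n)) (sym (ℕ→ℚ-homo-* (suc n) (n !))) ⟩
    ℕ→ℚ (suc n !) * invFact (suc n)
  ≡⟨ trans (ℕ→ℚ-!-*-invFact (suc n)) (sym (ℕ→ℚ-!-*-invFact n)) ⟩
    ℕ→ℚ (n !) * invFact n
  ∎)
  where open ≡-Reasoning

expNeg≡𝟙-oneMinusExpNeg : ∀ i → expNeg i ≡ 𝟙 i - oneMinusExpNeg i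
expNeg≡𝟙-oneMinusExpNeg zero    = refl
expNeg≡𝟙-oneMinusExpNeg (suc i) = solve 1 (λ x → x := con 0ℚ :- (:- x)) refl (expNeg (suc i))

∂-oneMinusExpNeg : ∀ i → ∂ oneMinusExpNeg i ≡ 𝟙 i - oneMinusExpNeg i
∂-oneMinusExpNeg i = begin
    ℕ→ℚ (suc i) * (- ((- 1ℚ * alt i) * invFact (suc i)))
  ≡⟨ solve 3 (λ N A I → N :* (:- ((:- con 1ℚ :* A) :* I)) := A :* (N :* I)) refl (ℕ→ℚ (suc i)) (alt i) (invFact (suc i)) ⟩
    alt i * (ℕ→ℚ (suc i) * invFact (suc i))
  ≡⟨ cong (alt i *_) (invFact-suc i) ⟩
    expNeg i
  ≡⟨ expNeg≡𝟙-oneMinusExpNeg i ⟩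
    𝟙 i - oneMinusExpNeg i
  ∎
  where open ≡-Reasoning

oneMinusExpNeg-reflect : ∀ i → oneMinusExpNeg i ≡ - (alt i * expMinusOne i)
oneMinusExpNeg-reflect zero    = refl
oneMinusExpNeg-reflect (suc i) = refl

expNeg-⊛-^S : ∀ k n →
  ℕ→ℚ (suc k) * (expNeg ⊛ (oneMinusExpNeg ^S k)) n ≡ ℕ→ℚ (suc n) * (oneMinusExpNeg ^S suc k) (suc n)
expNeg-⊛-^S k n = begin
    ℕ→ℚ (suc k) * (expNeg ⊛ (g ^S k)) n
  ≡⟨ cong (ℕ→ℚ (suc k) *_) (⊛-congˡ (g ^S k) expNeg≡𝟙-oneMinusExpNeg n) ⟩
    ℕ→ℚ (suc k) * ((λ i → 𝟙 i - g i) ⊛ (g ^S k)) n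
  ≡⟨ cong (ℕ→ℚ (suc k) *_) (⊛-distribʳ-- 𝟙 g (g ^S k) n) ⟩
    ℕ→ℚ (suc k) * ((𝟙 ⊛ (g ^S k)) n - (g ^S suc k) n)
  ≡⟨ cong (λ x → ℕ→ℚ (suc k) * (x - (g ^S suc k) n)) (⊛-identityˡ (g ^S k) n) ⟩
    ℕ→ℚ (suc k) * ((g ^S k) n - (g ^S suc k) n)
  ≡⟨ sym (∂-^S g ∂-oneMinusExpNeg k n) ⟩
    ∂ (g ^S suc k) n
  ∎
  where
  open ≡-Reasoning
  g = oneMinusExpNeg

ℕ→ℚ-!-*-stirling2 : ∀ N m → ℕ→ℚ (m !) * stirling2 N m ≡ ℕ→ℚ (N !) * (expMinusOne ^S m) N
ℕ→ℚ-!-*-stirling2 N m = begin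
    ℕ→ℚ (m !) * (ℕ→ℚ (N !) * invFact m * (expMinusOne ^S m) N)
  ≡⟨ solve 4 (λ M F I E → M :* (F :* I :* E) := F :* E :* (M :* I)) refl (ℕ→ℚ (m !)) (ℕ→ℚ (N !)) (invFact m) ((expMinusOne ^S m) N) ⟩
    ℕ→ℚ (N !) * (expMinusOne ^S m) N * (ℕ→ℚ (m !) * invFact m)
  ≡⟨ cong (ℕ→ℚ (N !) * (expMinusOne ^S m) N *_) (ℕ→ℚ-!-*-invFact m) ⟩
    ℕ→ℚ (N !) * (expMinusOne ^S m) N * 1ℚ
  ≡⟨ *-identityʳ _ ⟩
    ℕ→ℚ (N !) * (expMinusOne ^S m) N
  ∎
  where open ≡-Reasoning

ℕ→ℚ-!-*-expNeg-⊛-^S : ∀ n k →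
  ℕ→ℚ (n !) * (expNeg ⊛ (oneMinusExpNeg ^S k)) n ≡ alt n * (alt k * ℕ→ℚ (k !) * stirling2 (suc n) (suc k))
ℕ→ℚ-!-*-expNeg-⊛-^S n k = ℕ→ℚ-cancelˡ (suc k) (begin
    K₁ * (F * X)
  ≡⟨ solve 3 (λ K₁ F X → K₁ :* (F :* X) := F :* (K₁ :* X)) refl K₁ F X ⟩
    F * (K₁ * X)
  ≡⟨ cong (F *_) (expNeg-⊛-^S k n) ⟩
    F * (ℕ→ℚ (suc n) * (oneMinusExpNeg ^S suc k) (suc n))
  ≡⟨ cong (λ x → F * (ℕ→ℚ (suc n) * x)) (^S-reflect oneMinusExpNeg expMinusOne oneMinusExpNeg-reflect (suc k) (suc n)) ⟩
    F * (ℕ→ℚ (suc n) * (alt (suc k) * alt (suc n) * E))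
  ≡⟨ solve 5 (λ F N Ak An E → F :* (N :* ((:- con 1ℚ :* Ak) :* (:- con 1ℚ :* An) :* E)) := Ak :* An :* ((N :* F) :* E))
       refl F (ℕ→ℚ (suc n)) (alt k) (alt n) E ⟩
    alt k * alt n * ((ℕ→ℚ (suc n) * F) * E)
  ≡⟨ cong (λ x → alt k * alt n * (x * E)) (sym (ℕ→ℚ-homo-* (suc n) (n !))) ⟩
    alt k * alt n * (ℕ→ℚ (suc n !) * E)
  ≡⟨ cong (alt k * alt n *_) (sym (ℕ→ℚ-!-*-stirling2 (suc n) (suc k))) ⟩
    alt k * alt n * (ℕ→ℚ (suc k !) * S)
  ≡⟨ cong (λ x → alt k * alt n * (x * S)) (ℕ→ℚ-homo-* (suc k) (k !)) ⟩
    alt k * alt n * ((K₁ * ℕ→ℚ (k !)) * S)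
  ≡⟨ solve 5 (λ Ak An K₁ K S → Ak :* An :* ((K₁ :* K) :* S) := K₁ :* (An :* (Ak :* K :* S))) refl (alt k) (alt n) K₁ (ℕ→ℚ (k !)) S ⟩
    K₁ * (alt n * (alt k * ℕ→ℚ (k !) * S))
  ∎)
  where
  open ≡-Reasoning
  K₁ = ℕ→ℚ (suc k)
  F = ℕ→ℚ (n !)
  X = (expNeg ⊛ (oneMinusExpNeg ^S k)) n
  E = (expMinusOne ^S suc k) (suc n)
  S = stirling2 (suc n) (suc k)

theorem2p7 : (r : ℕ) (s₁ : ℤ) (s : Vec ℤ r) (ε₁ : Sign) (ε : Vec Sign r) (n : ℕ) → n ≥ 1 →
    C (s₁ ∷ s) (ε₁ ∷ ε) n
      ≡ ((- 1ℚ) ^ℚ n) * sumBelow (suc (suc n)) (λ m₁ →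
          term s₁ ε₁ m₁ * ((- 1ℚ) ^ℚ (m₁ ∸ 1)) * ℕ→ℚ ((m₁ ∸ 1) !) * stirling2 (suc n) m₁
            * nested s ε m₁)
theorem2p7 _ s₁ s ε₁ ε n _ = begin
    F * (expNeg ⊛ subst A g) n
  ≡⟨ cong (F *_) (⊛-subst expNeg A g refl n) ⟩
    F * sumBelow (suc n) (λ k → A k * (expNeg ⊛ (g ^S k)) n)
  ≡⟨ *-distribˡ-sumBelow (suc n) F _ ⟩
    sumBelow (suc n) (λ k → F * (A k * (expNeg ⊛ (g ^S k)) n))
  ≡⟨ sumBelow-cong (suc n) (λ k _ → summand k) ⟩
    sumBelow (suc n) (λ k → alt n * h (suc k))
  ≡⟨ sym (*-distribˡ-sumBelow (suc n) (alt n) (λ k → h (suc k))) ⟩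
    alt n * sumBelow (suc n) (λ k → h (suc k))
  ≡⟨ cong (alt n *_) (sym (sumBelow-suc-of-zero (suc n) h h0≡0)) ⟩
    alt n * sumBelow (suc (suc n)) h
  ∎
  where
  open ≡-Reasoning
  F = ℕ→ℚ (n !)
  A = liOverT (s₁ ∷ s) (ε₁ ∷ ε)
  g = oneMinusExpNeg
  h : ℕ → ℚ
  h m₁ = term s₁ ε₁ m₁ * alt (m₁ ∸ 1) * ℕ→ℚ ((m₁ ∸ 1) !) * stirling2 (suc n) m₁ * nested s ε m₁

  summand : ∀ k → F * (A k * (expNeg ⊛ (g ^S k)) n) ≡ alt n * h (suc k)
  summand k = begin
      F * (T * N * X)
    ≡⟨ solve 4 (λ F T N X → F :* (T :* N :* X) := T :* N :* (F :* X)) refl F T N X ⟩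
      T * N * (F * X)
    ≡⟨ cong (T * N *_) (ℕ→ℚ-!-*-expNeg-⊛-^S n k) ⟩
      T * N * (alt n * (alt k * ℕ→ℚ (k !) * S))
    ≡⟨ solve 6 (λ T N An Ak K S → T :* N :* (An :* (Ak :* K :* S)) := An :* (T :* Ak :* K :* S :* N)) refl
         T N (alt n) (alt k) (ℕ→ℚ (k !)) S ⟩
      alt n * h (suc k)
    ∎
    where
    T = term s₁ ε₁ (suc k)
    N = nested s ε (suc k)
    X = (expNeg ⊛ (g ^S k)) n
    S = stirling2 (suc n) (suc k)

  h0≡0 : h 0 ≡ 0ℚ
  h0≡0 = solve 4 (λ a b c d → con 0ℚ :* a :* b :* c :* d := con 0ℚ) refl
    (alt 0) (ℕ→ℚ (0 !)) (stirling2 (suc n) 0) (nested s ε 0)
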